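{- Let $T$ be a tree with $|E(T)|\ge 3$ and $sp(T)=\Delta(T)$, and let $B=\{v\in V(T): d_T(v)<\Delta(T)\}$. Then for every $v\in B$ and every $(\Delta(T)-1)$-edge-colorable subgraph $H$ of $T$ satisfying either $V(H)=V(T)$ or $V(T)\setminus V(H)=\{v\}$, one has $V(T)\setminus V(H)=\{v\}$.
   Context: $\Delta(T)$ is the maximum degree of $T$. A graph is $k$-edge-colorable if its edge set can be partitioned into $k$ matchings. $V(H)$ denotes the set of vertices of $T$ of degree at least $1$ in $H$. For a graph $G$ without isolated vertices, $sp(G)$ is the least integer $k$ such that $G$ has a subgraph $H$ with $V(H)=V(G)$ and $1\le d_H(x)\le k$ for all vertices $x$ (equivalently, the least $k$ such that $G$ has a $k$-edge-colorable subgraph covering all vertices). (Such subgraphs $H$ exist for every $v\in B$ whenever $|V(T)|\ge 3$.) -}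

module Defs where

open import Data.Nat using (ℕ; zero; suc; _+_; _≤_; _<_; _⊔_)
open import Data.Bool using (Bool; true; false; if_then_else_)
open import Data.Fin using (Fin; toℕ)
open import Data.List using (List; []; _∷_; _++_; [_]; length; map; foldr; allFin; concatMap)
open import Data.Nat.ListAction using (sum)
open import Data.List.Relation.Unary.Unique.Propositional using (Unique)
open import Data.List.Relation.Unary.Linked using (Linked)
open import Data.Product using (Σ; _×_; ∃; ∃-syntax)
open import Relation.Binary.PropositionalEquality using (_≡_; _≢_)
open import Relation.Nullary using (¬_)

record Graph (n : ℕ) : Set where
  field
    adj    : Fin n → Fin n → Bool
    sym    : ∀ x y → adj x y ≡ adj y x
    irrefl : ∀ x → adj x x ≡ false
open Graph public

Adj : ∀ {n} → Graph n → Fin n → Fin n → Set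
Adj G x y = adj G x y ≡ true

b2n : Bool → ℕ
b2n true  = 1
b2n false = 0

deg : ∀ {n} → Graph n → Fin n → ℕ
deg {n} G x = sum (map (λ y → b2n (adj G x y)) (allFin n))

Δ : ∀ {n} → Graph n → ℕ
Δ {n} G = foldr _⊔_ 0 (map (deg G) (allFin n))

ltB : ℕ → ℕ → Bool
ltB zero    zero    = false
ltB zero    (suc _) = true
ltB (suc _) zero    = false
ltB (suc m) (suc k) = ltB m k

andB : Bool → Bool → Bool
andB true b  = b
andB false _ = false

numEdges : ∀ {n} → Graph n → ℕ
numEdges {n} G =
  sum (concatMap (λ x → map (λ y → b2n (andB (ltB (toℕ x) (toℕ y)) (adj G x y))) (allFin n)) (allFin n))

data Walk {n : ℕ} (G : Graph n) : Fin n → Fin n → Set where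
  nil  : ∀ {x} → Walk G x x
  cons : ∀ {x y z} → Adj G x y → Walk G y z → Walk G x z

Connected : ∀ {n} → Graph n → Set
Connected G = ∀ x y → Walk G x y

-- a cycle x, v1, ..., vk, x with k ≥ 2 and all of x, v1..vk distinct
HasCycle : ∀ {n} → Graph n → Set
HasCycle {n} G = Σ (Fin n) λ x → Σ (List (Fin n)) λ rest →
  (2 ≤ length rest) × Unique (x ∷ rest) × Linked (Adj G) (x ∷ rest ++ [ x ])

IsTree : ∀ {n} → Graph n → Set
IsTree G = Connected G × ¬ HasCycle G

-- H is a subgraph of G (on the same ambient vertex set; V(H) is
-- the set of vertices of degree ≥ 1 in H)
_⊆G_ : ∀ {n} → Graph n → Graph n → Set
H ⊆G G = ∀ x y → Adj H x y → Adj G x y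

InV : ∀ {n} → Graph n → Fin n → Set
InV H x = 1 ≤ deg H x

EdgeColorable : ∀ {n} → ℕ → Graph n → Set
EdgeColorable {n} k H = Σ (Fin n → Fin n → Fin k) λ c →
  (∀ x y → Adj H x y → c x y ≡ c y x) ×
  (∀ x y z → Adj H x y → Adj H x z → y ≢ z → c x y ≢ c x z)

HasSpanning : ∀ {n} → Graph n → ℕ → Set
HasSpanning {n} G k = Σ (Graph n) λ H → H ⊆G G × (∀ x → 1 ≤ deg H x × deg H x ≤ k)

SpIs : ∀ {n} → Graph n → ℕ → Set
SpIs G k = HasSpanning G k × (∀ j → HasSpanning G j → k ≤ j)

module Submission where

-- If H covers every vertex of T, then H witnesses
-- sp(T) ≤ Δ(T) - 1: it is a subgraph of T with 1 ≤ d_H(x) for all x, and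
-- in a (Δ(T) - 1)-edge-colouring the edges at x carry pairwise distinct
-- colours, so d_H(x) ≤ Δ(T) - 1.  This contradicts sp(T) = Δ(T), because
-- Δ(T) ≥ 1 (some vertex, v, has degree below Δ(T)).  Hence only the second
-- alternative, V(T) \ V(H) = {v}, can hold.  Only the minimality part of
-- sp(T) = Δ(T) is used.

open import Defs
open import Data.Nat using (suc; z≤n; _+_; _≤_; _<_; _∸_)
open import Data.Nat.Properties using (1+n≰n; ≤-<-trans; module ≤-Reasoning)
open import Data.Bool using (Bool; true; false; _≟_)
open import Data.Fin using (Fin; zero; suc)
open import Data.Fin.Properties using (injective⇒≤)
open import Data.List using (List; []; _∷_; length; map; filter; lookup; allFin)
open import Data.List.Properties using (length-map)
open import Data.Nat.ListAction using (sum)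
open import Data.List.Membership.Propositional.Properties using (∈-lookup)
open import Data.List.Membership.Propositional using (_∈_)
open import Data.List.Relation.Unary.All using (All; []; _∷_)
import Data.List.Relation.Unary.All as All
open import Data.List.Relation.Unary.All.Properties using (all-filter)
open import Data.List.Relation.Unary.AllPairs using (AllPairs; []; _∷_)
import Data.List.Relation.Unary.AllPairs.Properties as AllPairsₚ
open import Data.List.Relation.Unary.Unique.Propositional using (Unique)
open import Data.List.Relation.Unary.Unique.Propositional.Properties
  using (allFin⁺; filter⁺; Unique[x∷xs]⇒x∉xs)
open import Data.Product using (_×_; _,_)
open import Data.Sum using (_⊎_; inj₁; inj₂)
open import Function using (_∘_)
open import Relation.Binary.PropositionalEquality using (_≡_; _≢_; refl; cong; subst) renaming (sym to ≡-sym)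
open import Relation.Nullary using (¬_; Dec; contradiction)

lookup-injective : ∀ {a} {A : Set a} {xs : List A} → Unique xs →
                   ∀ i j → lookup xs i ≡ lookup xs j → i ≡ j
lookup-injective {xs = []}    _       ()      _       _
lookup-injective {xs = _ ∷ _} u       zero    zero    _  = refl
lookup-injective {xs = _ ∷ _} u       zero    (suc j) eq =
  contradiction (subst (_∈ _) (≡-sym eq) (∈-lookup j)) (Unique[x∷xs]⇒x∉xs u)
lookup-injective {xs = _ ∷ _} u       (suc i) zero    eq =
  contradiction (subst (_∈ _) eq (∈-lookup i)) (Unique[x∷xs]⇒x∉xs u)
lookup-injective {xs = _ ∷ _} (_ ∷ u) (suc i) (suc j) eq =
  cong suc (lookup-injective u i j eq)

unique-length≤ : ∀ {k} (xs : List (Fin k)) → Unique xs → length xs ≤ k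
unique-length≤ xs u = injective⇒≤ (λ {i} {j} → lookup-injective u i j)

count-filter : ∀ {a} {A : Set a} (g : A → Bool) (xs : List A) →
               sum (map (b2n ∘ g) xs) ≡ length (filter (λ y → g y ≟ true) xs)
count-filter g []       = refl
count-filter g (x ∷ xs) with g x
... | true  = cong (1 +_) (count-filter g xs)
... | false = count-filter g xs

allPairs-restrict : ∀ {a p r} {A : Set a} {P : A → Set p} {R : A → A → Set r}
  {xs : List A} → (∀ {y z} → P y → P z → y ≢ z → R y z) →
  All P xs → Unique xs → AllPairs R xs
allPairs-restrict sep []         []         = []
allPairs-restrict sep (py ∷ pys) (y∉ ∷ u) =
  All.zipWith (λ (pz , y≢z) → sep py pz y≢z) (pys , y∉) ∷ allPairs-restrict sep pys u

-- Counting principle: if f separates the elements of a duplicate-free list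
-- that pass the test g, then at most k elements pass g (their images are
-- pairwise distinct elements of Fin k).
separated-count≤ : ∀ {a k} {A : Set a} (g : A → Bool) (f : A → Fin k)
  (xs : List A) → Unique xs →
  (∀ {y z} → g y ≡ true → g z ≡ true → y ≢ z → f y ≢ f z) →
  sum (map (b2n ∘ g) xs) ≤ k
separated-count≤ {k = k} g f xs u separates = begin
  sum (map (b2n ∘ g) xs) ≡⟨ count-filter g xs ⟩
  length passing         ≡⟨ ≡-sym (length-map f passing) ⟩
  length (map f passing) ≤⟨ unique-length≤ (map f passing) distinct-images ⟩
  k                      ∎
  where
  open ≤-Reasoning
  passes? : ∀ y → Dec (g y ≡ true)
  passes? y = g y ≟ true

  passing : List _
  passing = filter passes? xs

  distinct-images : Unique (map f passing)
  distinct-images = AllPairsₚ.map⁺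
    (allPairs-restrict separates (all-filter passes? xs) (filter⁺ passes? u))

edgeColorable⇒deg≤ : ∀ {n} k (H : Graph n) → EdgeColorable k H → ∀ x → deg H x ≤ k
edgeColorable⇒deg≤ {n} k H (c , _ , proper) x =
  separated-count≤ (adj H x) (c x) (allFin n) (allFin⁺ n) (proper x _ _)

positive⇒≰pred : ∀ {m} → 0 < m → ¬ (m ≤ m ∸ 1)
positive⇒≰pred {suc d} _ = 1+n≰n

mainTheorem7 : ∀ {n} (T : Graph n) → IsTree T → 3 ≤ numEdges T → SpIs T (Δ T) →
    ∀ (v : Fin n) → deg T v < Δ T →
    ∀ (H : Graph n) → H ⊆G T → EdgeColorable (Δ T ∸ 1) H →
    ((∀ x → InV H x) ⊎ (¬ InV H v × (∀ x → x ≢ v → InV H x))) →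
    (¬ InV H v × (∀ x → x ≢ v → InV H x))
mainTheorem7 T _ _ _           v _        H _   _   (inj₂ missesOnlyV) = missesOnlyV
mainTheorem7 T _ _ (_ , least) v deg<Δ H H⊆T col (inj₁ covers)        =
  contradiction (least (Δ T ∸ 1) H-witnesses-sp≤Δ-1) (positive⇒≰pred Δ-positive)
  where
  H-witnesses-sp≤Δ-1 : HasSpanning T (Δ T ∸ 1)
  H-witnesses-sp≤Δ-1 = H , H⊆T , λ x → covers x , edgeColorable⇒deg≤ (Δ T ∸ 1) H col x

  Δ-positive : 0 < Δ T
  Δ-positive = ≤-<-trans z≤n deg<Δ
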